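{- Let $t\ge2$ and consider an edge coloring of $K_n$ with colors $\{1,\ldots,t\}$, with color classes $H_1,\ldots,H_t$ (spanning subgraphs), such that $H_j$ is regular for every $j\geq 3$. Let $u,v,x_0$ be distinct vertices with $vx_{0}\in E(H_{1})$ and $x_{0}u\notin E(H_{1})$. Suppose that either there is a vertex $y\in N_{H_{2}}(v)\cap N_{H_{1}}(u)$, or there are vertices $y\in N_{H_{2}}(v)\setminus N_{H_{2}}(u)$ and $y'\in N_{H_{1}}(u)\setminus N_{H_{1}}(v)$ such that $yu$ and $vy'$ have the same color. Then there exists a $vx_{0}$ and $x_{0}u$ exchange.
   Context: For distinct vertices $u,v$ and vertex $x_0$, a $vx_0$ and $x_0u$ exchange is a list of $2l$ distinct edges $(vx_{0},x_{0}u,vx_{1},x_{1}u,\ldots,vx_{l-1},x_{l-1}u)$ of $K_n$ (some $l\ge1$) such that $x_{i}u$ and $vx_{i+1}$ have the same color for all $i$ modulo $l$. $N_{H}(w)$ denotes the neighborhood of $w$ in the graph $H$. -}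

module Defs where

open import Data.Nat using (ℕ; zero; suc; _≤_)
open import Data.Nat.DivMod using (_mod_)
open import Data.Fin using (Fin; toℕ; _≟_)
open import Data.List using (List; length; filter)
open import Data.List.Base using ()
open import Data.Fin.Base using ()
open import Data.List using (allFin)
open import Data.Product using (Σ; _×_; _,_; ∃)
open import Data.Sum using (_⊎_)
open import Relation.Nullary using (¬_; Dec; yes; no)
open import Relation.Nullary.Decidable using (_×-dec_; ¬?)
open import Relation.Binary.PropositionalEquality using (_≡_; _≢_)

-- An edge colouring of K_n with t colours: vertices Fin n, colours Fin t
-- (colour 1 is Fin index 0, colour j is index j-1).  c x y is the colour of
-- the edge xy for x ≢ y; values on the diagonal are irrelevant.
record Coloring (n t : ℕ) : Set where
  field
    col  : Fin n → Fin n → Fin t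
    symm : ∀ x y → col x y ≡ col y x
open Coloring public

InN : ∀ {n t} → Coloring n t → Fin t → Fin n → Fin n → Set
InN c j x w = (w ≢ x) × (col c x w ≡ j)

InN? : ∀ {n t} (c : Coloring n t) (j : Fin t) (x : Fin n) (w : Fin n) → Dec (InN c j x w)
InN? c j x w = ¬? (w ≟ x) ×-dec (col c x w ≟ j)

deg : ∀ {n t} → Coloring n t → Fin t → Fin n → ℕ
deg {n} c j x = length (filter (InN? c j x) (allFin n))

Regular : ∀ {n t} → Coloring n t → Fin t → Set
Regular {n} c j = Σ ℕ λ d → ∀ (x : Fin n) → deg c j x ≡ d

SameEdge : ∀ {n} → (Fin n × Fin n) → (Fin n × Fin n) → Set
SameEdge (a , b) (a' , b') = ((a ≡ a') × (b ≡ b')) ⊎ ((a ≡ b') × (b ≡ a'))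

next : ∀ {m} → Fin (suc m) → Fin (suc m)
next {m} i = suc (toℕ i) mod (suc m)

-- A vx₀ and x₀u exchange: l = suc m ≥ 1 and vertices x₀,…,x_{l-1} (x : Fin l → Fin n,
-- x 0 = x₀) such that the 2l pairs vx_i, x_i u are edges of K_n, pairwise distinct,
-- and colour(x_i u) = colour(v x_{i+1 mod l}) for all i.
Exchange : ∀ {n t} → Coloring n t → (v x₀ u : Fin n) → Set
Exchange {n} c v x₀ u =
  Σ ℕ λ m → Σ (Fin (suc m) → Fin n) λ x →
    (x Data.Fin.zero ≡ x₀)
    × (∀ i → v ≢ x i)
    × (∀ i → x i ≢ u)
    × (∀ i j → i ≢ j → ¬ SameEdge (v , x i) (v , x j))
    × (∀ i j → i ≢ j → ¬ SameEdge (x i , u) (x j , u))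
    × (∀ i j → ¬ SameEdge (v , x i) (x j , u))
    × (∀ i → col c (x i) u ≡ col c v (x (next i)))

-- For each regular colour j ≥ 3, N_{H_j}(u) ∖ {v} and N_{H_j}(v) ∖ {u} have equal size
-- (v ∈ N_{H_j}(u) iff u ∈ N_{H_j}(v)), so one injects into the other; gluing these over j
-- gives an injection φ with col(v φ(w)) = col(w u) whenever col(w u) ≥ 3.  Iterate φ from x₀.
-- As col(v x₀) = 1 while every φ-image has v-colour ≥ 3, the orbit cannot return to x₀ and,
-- φ being injective, never repeats a vertex; by pigeonhole it stops at some x_K with
-- col(x_K u) ∈ {1, 2}.  Colour 1 closes the exchange at once; colour 2 is closed by
-- appending y, resp. y and y′, from the hypothesis.
module Submission where

open import Defs
open import Data.Nat using (ℕ; zero; suc; _≤_; _<_; z≤n; s≤s; s≤s⁻¹; _%_)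
open import Data.Nat.Properties using (≤-refl; ≤-reflexive; <⇒≤; <⇒≢; n<1+n; m<n⇒m<1+n; m≤n⇒m<n∨m≡n; _≤?_)
open import Data.Nat.DivMod using (m<n⇒m%n≡m; n%n≡0; m%n<n)
open import Data.Nat.GeneralisedArithmetic using (fold)
open import Data.Fin using (Fin; zero; suc; toℕ; fromℕ<; _≟_)
open import Data.Fin.Properties
  using (toℕ-injective; toℕ≤pred[n]; toℕ-fromℕ<; toℕ-inject; 0≢1+n; pigeonhole; ¬∀⟶∃¬-smallest)
open import Data.List using (List; []; _∷_; length; filter; allFin)
open import Data.List.Membership.Propositional using (_∈_)
open import Data.List.Membership.Propositional.Properties using (∈-filter⁺; ∈-filter⁻; ∈-allFin)
open import Data.List.Relation.Unary.Any using (here; there; tail)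
import Data.List.Relation.Unary.All as All
open import Data.List.Relation.Unary.AllPairs using (_∷_)
open import Data.List.Relation.Unary.Unique.Propositional using (Unique)
open import Data.List.Relation.Unary.Unique.Propositional.Properties using (allFin⁺; filter⁺)
open import Data.Product using (Σ; _×_; _,_; proj₁; proj₂)
open import Data.Sum using (_⊎_; inj₁; inj₂; [_,_])
import Data.Sum as Sum
open import Data.Empty using (⊥-elim)
open import Function using (id; _∘_)
open import Relation.Binary using (DecidableEquality)
open import Relation.Nullary using (¬_; Dec; yes; no; contradiction)
open import Relation.Nullary.Decidable using (_×-dec_; ¬?)
open import Relation.Unary using (Decidable; _∖_; ｛_｝)
open import Relation.Binary.PropositionalEquality using (_≡_; _≢_; refl; sym; trans; cong; subst)

record InjectionOn {A : Set} (P Q : A → Set) : Set where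
  field
    to        : A → A
    maps      : ∀ {x} → P x → Q (to x)
    injective : ∀ {x y} → P x → P y → to x ≡ to y → x ≡ y
open InjectionOn

module _ {A : Set} (_≟ᴬ_ : DecidableEquality A) where

  list-injection : (xs ys : List A) → Unique ys → length xs ≤ length ys
    → InjectionOn (_∈ xs) (_∈ ys)
  list-injection [] ys _ _ = record { to = id ; maps = λ () ; injective = λ () }
  list-injection (x ∷ xs) (y ∷ ys) (y∉ys ∷ ys!) (s≤s le) =
    record { to = f ; maps = f-maps ; injective = f-injective }
    where
    ι : InjectionOn (_∈ xs) (_∈ ys)
    ι = list-injection xs ys ys! le

    f : A → A
    f w with w ≟ᴬ x
    ... | yes _ = y
    ... | no _  = to ι w

    f-maps : ∀ {w} → w ∈ x ∷ xs → f w ∈ y ∷ ys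
    f-maps {w} w∈ with w ≟ᴬ x
    ... | yes _  = here refl
    ... | no w≢x = there (maps ι (tail w≢x w∈))

    y≢ι : ∀ {w} → w ∈ xs → y ≢ to ι w
    y≢ι w∈ = All.lookup y∉ys (maps ι w∈)

    f-injective : ∀ {w₁ w₂} → w₁ ∈ x ∷ xs → w₂ ∈ x ∷ xs → f w₁ ≡ f w₂ → w₁ ≡ w₂
    f-injective {w₁} {w₂} m₁ m₂ eq with w₁ ≟ᴬ x | w₂ ≟ᴬ x
    ... | yes w₁≡x | yes w₂≡x = trans w₁≡x (sym w₂≡x)
    ... | yes _    | no w₂≢x  = contradiction eq (y≢ι (tail w₂≢x m₂))
    ... | no w₁≢x  | yes _    = contradiction (sym eq) (y≢ι (tail w₁≢x m₁))
    ... | no w₁≢x  | no w₂≢x  = injective ι (tail w₁≢x m₁) (tail w₂≢x m₂) eq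

  -- The element sent to a is rerouted to the image of b.
  InjectionOn-∖ : ∀ {P Q : A → Set} {a b} → InjectionOn P Q → (Q a → P b)
    → InjectionOn (P ∖ ｛ b ｝) (Q ∖ ｛ a ｝)
  InjectionOn-∖ {P} {Q} {a} {b} ι Qa⇒Pb = record { to = f ; maps = f-maps ; injective = f-injective }
    where
    f : A → A
    f x with to ι x ≟ᴬ a
    ... | yes _ = to ι b
    ... | no _  = to ι x

    Pb : ∀ {x} → P x → to ι x ≡ a → P b
    Pb Px ιx≡a = Qa⇒Pb (subst Q ιx≡a (maps ι Px))

    f-maps : ∀ {x} → (P ∖ ｛ b ｝) x → (Q ∖ ｛ a ｝) (f x)
    f-maps {x} (Px , b≢x) with to ι x ≟ᴬ a
    ... | yes ιx≡a = maps ι (Pb Px ιx≡a)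
                   , λ a≡ιb → b≢x (injective ι (Pb Px ιx≡a) Px (sym (trans ιx≡a a≡ιb)))
    ... | no ιx≢a  = maps ι Px , λ a≡ιx → ιx≢a (sym a≡ιx)

    f-injective : ∀ {x y} → (P ∖ ｛ b ｝) x → (P ∖ ｛ b ｝) y → f x ≡ f y → x ≡ y
    f-injective {x} {y} (Px , b≢x) (Py , b≢y) eq with to ι x ≟ᴬ a | to ι y ≟ᴬ a
    ... | yes ιx≡a | yes ιy≡a = injective ι Px Py (trans ιx≡a (sym ιy≡a))
    ... | yes ιx≡a | no _     = contradiction (injective ι (Pb Px ιx≡a) Py eq) b≢y
    ... | no _     | yes ιy≡a = contradiction (injective ι (Pb Py ιy≡a) Px (sym eq)) b≢x
    ... | no _     | no _     = injective ι Px Py eq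

subset-injection : ∀ {n} {P Q : Fin n → Set} (P? : Decidable P) (Q? : Decidable Q)
  → length (filter P? (allFin n)) ≤ length (filter Q? (allFin n)) → InjectionOn P Q
subset-injection {n} {P} P? Q? le = record
  { to        = to ι
  ; maps      = λ Px → proj₂ (∈-filter⁻ Q? {xs = allFin n} (maps ι (∈P Px)))
  ; injective = λ Px Py → injective ι (∈P Px) (∈P Py)
  }
  where
  ι : InjectionOn (_∈ filter P? (allFin n)) (_∈ filter Q? (allFin n))
  ι = list-injection _≟_ (filter P? (allFin n)) (filter Q? (allFin n)) (filter⁺ Q? (allFin⁺ n)) le

  ∈P : ∀ {x} → P x → x ∈ filter P? (allFin n)
  ∈P {x} = ∈-filter⁺ P? (∈-allFin x)

InjectionOn-restrict : ∀ {A : Set} {P Q : A → Set} {R : Set} → Dec R → (R → InjectionOn P Q)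
  → InjectionOn (λ x → R × P x) (λ y → R × Q y)
InjectionOn-restrict (yes r) ι = record
  { to        = to (ι r)
  ; maps      = λ (r′ , Px) → r′ , maps (ι r) Px
  ; injective = λ (_ , Px) (_ , Py) → injective (ι r) Px Py
  }
InjectionOn-restrict (no ¬r) ι = record
  { to        = id
  ; maps      = λ (r , _) → contradiction r ¬r
  ; injective = λ (r , _) → contradiction r ¬r
  }

module Glue {J A : Set} {P Q : J → A → Set} (κ κ′ : A → J)
            (classified : ∀ {j y} → Q j y → κ′ y ≡ j)
            (ι : (j : J) → InjectionOn (P j) (Q j)) where

  glued : A → A
  glued x = to (ι (κ x)) x

  glued-class : ∀ {x} → P (κ x) x → κ′ (glued x) ≡ κ x
  glued-class {x} Px = classified (maps (ι (κ x)) Px)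

  glue : InjectionOn (λ x → P (κ x) x) (λ y → Q (κ′ y) y)
  glue = record
    { to        = glued
    ; maps      = λ {x} Px → subst (λ j → Q j (glued x)) (sym (glued-class Px)) (maps (ι (κ x)) Px)
    ; injective = glued-injective
    }
    where
    glued-injective : ∀ {x y} → P (κ x) x → P (κ y) y → glued x ≡ glued y → x ≡ y
    glued-injective {x} {y} Px Py eq =
      same-class (trans (sym (glued-class Px)) (trans (cong κ′ eq) (glued-class Py))) Px Py eq
      where
      same-class : ∀ {j₁ j₂} → j₁ ≡ j₂ → P j₁ x → P j₂ y → to (ι j₁) x ≡ to (ι j₂) y → x ≡ y
      same-class refl = injective (ι _)

module Orbit {n} {G Q : Fin n → Set} (ι : InjectionOn G Q) {x₀ : Fin n} (x₀∉Q : ¬ Q x₀) where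

  orbit : ℕ → Fin n
  orbit = fold x₀ (to ι)

  orbit-injective : ∀ {K} → (∀ k → k < K → G (orbit k))
    → ∀ {i j} → i ≤ K → j ≤ K → orbit i ≡ orbit j → i ≡ j
  orbit-injective good {zero}  {zero}  _  _  _  = refl
  orbit-injective good {zero}  {suc j} _  lj eq = contradiction (subst Q (sym eq) (maps ι (good j lj))) x₀∉Q
  orbit-injective good {suc i} {zero}  li _  eq = contradiction (subst Q eq (maps ι (good i li))) x₀∉Q
  orbit-injective good {suc i} {suc j} li lj eq =
    cong suc (orbit-injective good (<⇒≤ li) (<⇒≤ lj) (injective ι (good i li) (good j lj) eq))

  -- Pigeonhole: an orbit staying in G for n steps would repeat a vertex.
  orbit-exits : Decidable G → Σ ℕ λ K → (∀ k → k < K → G (orbit k)) × ¬ G (orbit K)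
  orbit-exits G? with ¬∀⟶∃¬-smallest (suc n) (G ∘ orbit ∘ toℕ) (G? ∘ orbit ∘ toℕ) never-exits
    where
    never-exits : ¬ (∀ (i : Fin (suc n)) → G (orbit (toℕ i)))
    never-exits always with pigeonhole (n<1+n n) (orbit ∘ toℕ)
    ... | i , j , i<j , eq =
      <⇒≢ i<j (orbit-injective good (toℕ≤pred[n] i) (toℕ≤pred[n] j) eq)
      where
      good : ∀ k → k < n → G (orbit k)
      good k k<n = subst (G ∘ orbit) (toℕ-fromℕ< (m<n⇒m<1+n k<n)) (always (fromℕ< (m<n⇒m<1+n k<n)))
  ... | i , ¬Gi , before = toℕ i , good , ¬Gi
    where
    good : ∀ k → k < toℕ i → G (orbit k)
    good k k<i = subst (G ∘ orbit) (trans (toℕ-inject (fromℕ< k<i)) (toℕ-fromℕ< k<i)) (before (fromℕ< k<i))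

snoc : ∀ {A : Set} → (ℕ → A) → ℕ → A → ℕ → A
snoc f m       z zero    = f zero
snoc f zero    z (suc k) = z
snoc f (suc m) z (suc k) = snoc (f ∘ suc) m z k

snoc-≤ : ∀ {A : Set} (f : ℕ → A) {m} z {k} → k ≤ m → snoc f m z k ≡ f k
snoc-≤ f {m}     z {zero}  _         = refl
snoc-≤ f {suc m} z {suc k} (s≤s k≤m) = snoc-≤ (f ∘ suc) z k≤m

snoc-last : ∀ {A : Set} (f : ℕ → A) m z → snoc f m z (suc m) ≡ z
snoc-last f zero    z = refl
snoc-last f (suc m) z = snoc-last (f ∘ suc) m z

≤-suc-cases : ∀ {k m} → k ≤ suc m → k ≤ m ⊎ k ≡ suc m
≤-suc-cases = Sum.map₁ s≤s⁻¹ ∘ m≤n⇒m<n∨m≡n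

toℕ-next-< : ∀ {m} (i : Fin (suc m)) → toℕ i < m → toℕ (next i) ≡ suc (toℕ i)
toℕ-next-< {m} i i<m = trans (toℕ-fromℕ< (m%n<n (suc (toℕ i)) (suc m))) (m<n⇒m%n≡m (s≤s i<m))

toℕ-next-≡ : ∀ {m} (i : Fin (suc m)) → toℕ i ≡ m → toℕ (next i) ≡ 0
toℕ-next-≡ {m} i i≡m = trans (toℕ-fromℕ< (m%n<n (suc (toℕ i)) (suc m)))
  (subst (λ a → suc a % suc m ≡ 0) (sym i≡m) (n%n≡0 (suc m)))

module _ {n t} (c : Coloring n t) (u v : Fin n) where

  -- An exchange x 0, …, x m without the closing condition col(x m u) = col(v x 0).
  record Chain (x : ℕ → Fin n) (m : ℕ) : Set where
    field
      avoids-v : ∀ {k} → k ≤ m → v ≢ x k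
      avoids-u : ∀ {k} → k ≤ m → x k ≢ u
      distinct : ∀ {i j} → i ≤ m → j ≤ m → x i ≡ x j → i ≡ j
      linked   : ∀ {k} → k < m → col c (x k) u ≡ col c v (x (suc k))
  open Chain

  Chain-snoc : ∀ {x m z} → Chain x m → v ≢ z → z ≢ u → (∀ {k} → k ≤ m → x k ≢ z)
    → col c (x m) u ≡ col c v z → Chain (snoc x m z) (suc m)
  Chain-snoc {x} {m} {z} ch v≢z z≢u fresh x[m]~z = record
    { avoids-v = λ k≤ → avoids-v′ (≤-suc-cases k≤)
    ; avoids-u = λ k≤ → avoids-u′ (≤-suc-cases k≤)
    ; distinct = λ i≤ j≤ → distinct′ (≤-suc-cases i≤) (≤-suc-cases j≤)
    ; linked   = λ k< → linked′ (≤-suc-cases k<)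
    }
    where
    y : ℕ → Fin n
    y = snoc x m z

    avoids-v′ : ∀ {k} → k ≤ m ⊎ k ≡ suc m → v ≢ y k
    avoids-v′ (inj₁ k≤m) rewrite snoc-≤ x z k≤m = avoids-v ch k≤m
    avoids-v′ (inj₂ refl) rewrite snoc-last x m z = v≢z

    avoids-u′ : ∀ {k} → k ≤ m ⊎ k ≡ suc m → y k ≢ u
    avoids-u′ (inj₁ k≤m) rewrite snoc-≤ x z k≤m = avoids-u ch k≤m
    avoids-u′ (inj₂ refl) rewrite snoc-last x m z = z≢u

    distinct′ : ∀ {i j} → i ≤ m ⊎ i ≡ suc m → j ≤ m ⊎ j ≡ suc m → y i ≡ y j → i ≡ j
    distinct′ (inj₁ i≤m) (inj₁ j≤m) rewrite snoc-≤ x z i≤m | snoc-≤ x z j≤m = distinct ch i≤m j≤m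
    distinct′ (inj₁ i≤m) (inj₂ refl) rewrite snoc-≤ x z i≤m | snoc-last x m z = ⊥-elim ∘ fresh i≤m
    distinct′ (inj₂ refl) (inj₁ j≤m) rewrite snoc-≤ x z j≤m | snoc-last x m z = ⊥-elim ∘ fresh j≤m ∘ sym
    distinct′ (inj₂ refl) (inj₂ refl) _ = refl

    linked′ : ∀ {k} → suc k ≤ m ⊎ suc k ≡ suc m → col c (y k) u ≡ col c v (y (suc k))
    linked′ {k} (inj₁ k<m) rewrite snoc-≤ x z (<⇒≤ k<m) | snoc-≤ x z k<m = linked ch k<m
    linked′ (inj₂ refl) rewrite snoc-≤ x {m} z {m} ≤-refl | snoc-last x m z = x[m]~z

  closed-chain⇒exchange : ∀ {x m} → Chain x m → v ≢ u → col c (x m) u ≡ col c v (x 0)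
    → Exchange c v (x 0) u
  closed-chain⇒exchange {x} {m} ch v≢u closes =
    m , y , refl , avoids-v ch ∘ bound , avoids-u ch ∘ bound
      , vy-distinct , yu-distinct , vy≢yu , linked-cyclically
    where
    y : Fin (suc m) → Fin n
    y i = x (toℕ i)

    bound : (i : Fin (suc m)) → toℕ i ≤ m
    bound = toℕ≤pred[n]

    y-injective : ∀ {i j} → y i ≡ y j → i ≡ j
    y-injective {i} {j} eq = toℕ-injective (distinct ch (bound i) (bound j) eq)

    vy-distinct : ∀ i j → i ≢ j → ¬ SameEdge (v , y i) (v , y j)
    vy-distinct i j i≢j (inj₁ (_ , eq)) = i≢j (y-injective eq)
    vy-distinct i j i≢j (inj₂ (eq , _)) = avoids-v ch (bound j) eq

    yu-distinct : ∀ i j → i ≢ j → ¬ SameEdge (y i , u) (y j , u)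
    yu-distinct i j i≢j (inj₁ (eq , _)) = i≢j (y-injective eq)
    yu-distinct i j i≢j (inj₂ (eq , _)) = avoids-u ch (bound i) eq

    vy≢yu : ∀ i j → ¬ SameEdge (v , y i) (y j , u)
    vy≢yu i j (inj₁ (eq , _)) = avoids-v ch (bound j) eq
    vy≢yu i j (inj₂ (eq , _)) = v≢u eq

    linked-cyclically : ∀ i → col c (y i) u ≡ col c v (y (next i))
    linked-cyclically i with m≤n⇒m<n∨m≡n (bound i)
    ... | inj₁ i<m  = trans (linked ch i<m) (cong (col c v ∘ x) (sym (toℕ-next-< i i<m)))
    ... | inj₂ i≡m  = trans (subst (λ k → col c (x k) u ≡ col c v (x 0)) (sym i≡m) closes)
                            (cong (col c v ∘ x) (sym (toℕ-next-≡ i i≡m)))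

InN-sym : ∀ {n t} (c : Coloring n t) {j x w} → InN c j x w → InN c j w x
InN-sym c (w≢x , cxw≡j) = w≢x ∘ sym , trans (symm c _ _) cxw≡j

neighbourhood-injection : ∀ {n t} (c : Coloring n t) {j u v} → deg c j u ≤ deg c j v
  → InjectionOn (InN c j u ∖ ｛ v ｝) (InN c j v ∖ ｛ u ｝)
neighbourhood-injection c le = InjectionOn-∖ _≟_ (subset-injection (InN? c _ _) (InN? c _ _) le) (InN-sym c)

-- The High colours are the regular ones, j ≥ 3 (index ≥ 2).
module ColourOrbit {k n} (c : Coloring n (suc (suc k)))
  (regular : ∀ (j : Fin (suc (suc k))) → 2 ≤ toℕ j → Regular c j)
  (u v : Fin n) (u≢v : u ≢ v) {x₀ : Fin n} (x₀≢u : x₀ ≢ u) (vx₀∈H₁ : InN c zero v x₀) where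

  Colour : Set
  Colour = Fin (suc (suc k))

  High : Colour → Set
  High j = 2 ≤ toℕ j

  ¬High-zero : ¬ High zero
  ¬High-zero ()

  ¬High-one : ¬ High (suc zero)
  ¬High-one (s≤s ())

  ¬High⇒≡0⊎≡1 : ∀ {j} → ¬ High j → j ≡ zero ⊎ j ≡ suc zero
  ¬High⇒≡0⊎≡1 {zero}        _     = inj₁ refl
  ¬High⇒≡0⊎≡1 {suc zero}    _     = inj₂ refl
  ¬High⇒≡0⊎≡1 {suc (suc j)} ¬high = contradiction (s≤s (s≤s z≤n)) ¬high

  colour-injection : (j : Colour)
    → InjectionOn (λ w → High j × (InN c j u ∖ ｛ v ｝) w) (λ y → High j × (InN c j v ∖ ｛ u ｝) y)
  colour-injection j = InjectionOn-restrict (2 ≤? toℕ j) (neighbourhood-injection c ∘ deg-≤ ∘ regular j)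
    where
    deg-≤ : Regular c j → deg c j u ≤ deg c j v
    deg-≤ (d , deg≡d) = ≤-reflexive (trans (deg≡d u) (sym (deg≡d v)))

  Source : Fin n → Set
  Source w = High (col c u w) × (InN c (col c u w) u ∖ ｛ v ｝) w

  Target : Fin n → Set
  Target y = High (col c v y) × (InN c (col c v y) v ∖ ｛ u ｝) y

  Source? : Decidable Source
  Source? w = (2 ≤? toℕ (col c u w)) ×-dec (InN? c (col c u w) u w ×-dec ¬? (v ≟ w))

  open Glue (col c u) (col c v) (λ (_ , (_ , cvy≡j) , _) → cvy≡j) colour-injection
    using (glue; glued-class)

  vx₀≡0 : col c v x₀ ≡ zero
  vx₀≡0 = proj₂ vx₀∈H₁

  x₀∉Target : ¬ Target x₀
  x₀∉Target (high , _) = ¬High-zero (subst High vx₀≡0 high)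

  open Orbit glue x₀∉Target

  K : ℕ
  K = proj₁ (orbit-exits Source?)

  good : ∀ k → k < K → Source (orbit k)
  good = proj₁ (proj₂ (orbit-exits Source?))

  orbit-in-Target : ∀ {k} → k < K → Target (orbit (suc k))
  orbit-in-Target {k} k<K = maps glue (good k k<K)

  orbit-avoids-v : ∀ {k} → k ≤ K → v ≢ orbit k
  orbit-avoids-v {zero}  _   = proj₁ vx₀∈H₁ ∘ sym
  orbit-avoids-v {suc k} k<K = proj₁ (proj₁ (proj₂ (orbit-in-Target k<K))) ∘ sym

  orbit-avoids-u : ∀ {k} → k ≤ K → orbit k ≢ u
  orbit-avoids-u {zero}  _   = x₀≢u
  orbit-avoids-u {suc k} k<K = proj₂ (proj₂ (orbit-in-Target k<K)) ∘ sym

  orbit-chain : Chain c u v orbit K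
  orbit-chain = record
    { avoids-v = orbit-avoids-v
    ; avoids-u = orbit-avoids-u
    ; distinct = orbit-injective good
    ; linked   = λ {k} k<K → trans (symm c (orbit k) u) (sym (glued-class (good k k<K)))
    }

  exit-colour : col c (orbit K) u ≡ zero ⊎ col c (orbit K) u ≡ suc zero
  exit-colour = Sum.map (trans (symm c (orbit K) u)) (trans (symm c (orbit K) u)) (¬High⇒≡0⊎≡1 ¬high)
    where
    ¬high : ¬ High (col c u (orbit K))
    ¬high high = proj₂ (proj₂ (orbit-exits Source?))
      (high , (orbit-avoids-u ≤-refl , refl) , orbit-avoids-v ≤-refl)

  v≢u : v ≢ u
  v≢u = u≢v ∘ sym

  orbit-avoids-H₂[v] : ∀ {y} → col c v y ≡ suc zero → ∀ {k} → k ≤ K → orbit k ≢ y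
  orbit-avoids-H₂[v] vy≡1 {zero}  _   x₀≡y = 0≢1+n (trans (sym vx₀≡0) (trans (cong (col c v) x₀≡y) vy≡1))
  orbit-avoids-H₂[v] vy≡1 {suc k} k<K eq =
    ¬High-one (subst High (trans (cong (col c v) eq) vy≡1) (proj₁ (orbit-in-Target k<K)))

  orbit-avoids-H₁[u] : col c (orbit K) u ≡ suc zero → ∀ {k} → k ≤ K → col c (orbit k) u ≢ zero
  orbit-avoids-H₁[u] ≡1 k≤K with m≤n⇒m<n∨m≡n k≤K
  ... | inj₁ k<K  = λ ≡0 → ¬High-zero (subst High (trans (symm c u _) ≡0) (proj₁ (good _ k<K)))
  ... | inj₂ refl = λ ≡0 → 0≢1+n (trans (sym ≡0) ≡1)

  close-at-orbit : col c (orbit K) u ≡ zero → Exchange c v x₀ u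
  close-at-orbit ≡0 = closed-chain⇒exchange c u v orbit-chain v≢u (trans ≡0 (sym vx₀≡0))

  orbit-then : ∀ {y} → col c (orbit K) u ≡ suc zero → InN c (suc zero) v y → y ≢ u
    → Chain c u v (snoc orbit K y) (suc K)
  orbit-then ≡1 (y≢v , vy≡1) y≢u =
    Chain-snoc c u v orbit-chain (y≢v ∘ sym) y≢u (orbit-avoids-H₂[v] vy≡1) (trans ≡1 (sym vy≡1))

  close-via-y : col c (orbit K) u ≡ suc zero
    → (Σ (Fin n) λ y → InN c (suc zero) v y × InN c zero u y) → Exchange c v x₀ u
  close-via-y ≡1 (y , vy∈H₂ , (y≢u , uy≡0)) =
    closed-chain⇒exchange c u v (orbit-then ≡1 vy∈H₂ y≢u) v≢u closes
    where
    closes : col c (snoc orbit K y (suc K)) u ≡ col c v x₀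
    closes rewrite snoc-last orbit K y = trans (symm c y u) (trans uy≡0 (sym vx₀≡0))

  close-via-y-y′ : col c (orbit K) u ≡ suc zero
    → (Σ (Fin n) λ y → Σ (Fin n) λ y′ →
         InN c (suc zero) v y × ¬ InN c (suc zero) u y
         × InN c zero u y′ × ¬ InN c zero v y′
         × y ≢ u × v ≢ y′
         × col c y u ≡ col c v y′)
    → Exchange c v x₀ u
  close-via-y-y′ ≡1 (y , y′ , vy∈H₂ , uy∉H₂ , (y′≢u , uy′≡0) , _ , y≢u , v≢y′ , yu≡vy′) =
    closed-chain⇒exchange c u v
      (Chain-snoc c u v (orbit-then ≡1 vy∈H₂ y≢u) v≢y′ y′≢u fresh linked) v≢u closes
    where
    y′u≡0 : col c y′ u ≡ zero
    y′u≡0 = trans (symm c y′ u) uy′≡0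

    -- Before y every vertex x has col(x u) ≠ colour 1, and y = y′ would put y in N_{H₂}(u).
    fresh : ∀ {k} → k ≤ suc K → snoc orbit K y k ≢ y′
    fresh k≤ with ≤-suc-cases k≤
    ... | inj₁ k≤K rewrite snoc-≤ orbit y k≤K = λ eq →
      orbit-avoids-H₁[u] ≡1 k≤K (trans (cong (λ w → col c w u) eq) y′u≡0)
    ... | inj₂ refl rewrite snoc-last orbit K y = λ y≡y′ →
      uy∉H₂ (y≢u , trans (symm c u y) (trans yu≡vy′ (trans (cong (col c v) (sym y≡y′)) (proj₂ vy∈H₂))))

    linked : col c (snoc orbit K y (suc K)) u ≡ col c v y′
    linked rewrite snoc-last orbit K y = yu≡vy′

    closes : col c (snoc (snoc orbit K y) (suc K) y′ (suc (suc K))) u ≡ col c v x₀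
    closes rewrite snoc-last (snoc orbit K y) (suc K) y′ = trans y′u≡0 (sym vx₀≡0)

lemma3p3 : (k n : ℕ) (c : Coloring n (suc (suc k)))
    → (∀ (j : Fin (suc (suc k))) → 2 ≤ toℕ j → Regular c j)
    → (u v x₀ : Fin n) → u ≢ v → u ≢ x₀ → v ≢ x₀
    → InN c zero v x₀
    → ¬ InN c zero x₀ u
    → ((Σ (Fin n) λ y → InN c (suc zero) v y × InN c zero u y)
       ⊎ (Σ (Fin n) λ y → Σ (Fin n) λ y' →
            InN c (suc zero) v y × ¬ InN c (suc zero) u y
            × InN c zero u y' × ¬ InN c zero v y'
            × y ≢ u × v ≢ y'
            × col c y u ≡ col c v y'))
    → Exchange c v x₀ u
lemma3p3 k n c regular u v x₀ u≢v u≢x₀ _ vx₀∈H₁ _ hyp =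
  [ close-at-orbit , (λ exit≡1 → [ close-via-y exit≡1 , close-via-y-y′ exit≡1 ] hyp) ] exit-colour
  where open ColourOrbit c regular u v u≢v (u≢x₀ ∘ sym) vx₀∈H₁
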